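{- Let $G$ be a connected finite graph and $H$ a (nonempty) connected induced subgraph of $G$. Then $\operatorname{mic}(G)\ge\operatorname{mic}(H)+|G-H|$. In particular, $\operatorname{mic}(G)\ge|G|-1$.
   Context: $\operatorname{mic}(F)$ is the maximum of $\sum_{v\in I}d_F(v)$ over all independent sets $I$ of $F$. $|G-H|$ is the number of vertices of $G$ not in $H$. -}

module Defs where

open import Data.Nat using (ℕ; zero; suc; _+_; _⊔_)
open import Data.Bool using (Bool; true; false; _∧_; not; if_then_else_)
open import Data.Fin using (Fin)
open import Data.Vec using (Vec; []; _∷_; lookup; tabulate; map; foldr)
open import Data.List using (List; []; _∷_; _++_)
import Data.List as L
open import Data.Fin.Subset using (Subset; _∈_; ⊤; ∣_∣)
open import Data.Product using (∃; _×_)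
open import Relation.Binary.PropositionalEquality using (_≡_)

record Graph (n : ℕ) : Set where
  field
    adj   : Fin n → Fin n → Bool
    sym   : ∀ u v → adj u v ≡ adj v u
    irrefl : ∀ v → adj v v ≡ false
open Graph public

sumV : ∀ {n} → Vec ℕ n → ℕ
sumV = foldr _ _+_ 0

andV : ∀ {n} → Vec Bool n → Bool
andV = foldr _ _∧_ true

allSubsets : (n : ℕ) → List (Subset n)
allSubsets zero = [] ∷ []
allSubsets (suc n) = L.map (true ∷_) (allSubsets n) ++ L.map (false ∷_) (allSubsets n)

-- Subgraphs of G are induced subgraphs G[S], given by a vertex subset S.
-- Degree of v in G[S]: number of neighbours of v lying in S.
deg : ∀ {n} → Graph n → Subset n → Fin n → ℕ
deg G S v = sumV (tabulate λ u → if lookup S u ∧ adj G v u then 1 else 0)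

independent? : ∀ {n} → Graph n → Subset n → Subset n → Bool
independent? G S I =
  andV (tabulate λ u → not (lookup I u) ∨' lookup S u)
  ∧ andV (tabulate λ u → andV (tabulate λ v →
      not (lookup I u ∧ lookup I v ∧ adj G u v)))
  where
  _∨'_ : Bool → Bool → Bool
  true ∨' _ = true
  false ∨' b = b

degSum : ∀ {n} → Graph n → Subset n → Subset n → ℕ
degSum G S I = sumV (tabulate λ v → if lookup I v then deg G S v else 0)

-- mic(G[S]) = maximum of degSum over independent sets of G[S]
-- (the empty set is independent, so the maximum over the list with 0 default is exact).
mic : ∀ {n} → Graph n → Subset n → ℕ
mic {n} G S = L.foldr _⊔_ 0
  (L.map (λ I → if independent? G S I then degSum G S I else 0) (allSubsets n))

data Reach {n} (G : Graph n) (S : Subset n) : Fin n → Fin n → Set where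
  here : ∀ {v} → v ∈ S → Reach G S v v
  step : ∀ {u w v} → u ∈ S → adj G u w ≡ true → Reach G S w v → Reach G S u v

Connected : ∀ {n} → Graph n → Subset n → Set
Connected G S = ∀ u v → u ∈ S → v ∈ S → Reach G S u v

NonEmpty : ∀ {n} → Subset n → Set
NonEmpty S = ∃ λ v → v ∈ S

-- Grow H one vertex at a time along an edge uv with u ∈ H and v ∉ H; connectivity of G
-- provides such an edge while H ≠ G, and H + v is again connected. Each step raises mic by
-- at least one: take an independent set I of H. If v has a neighbour x ∈ I, then I is
-- still independent in H + v and the degree of x has grown; otherwise I + v is independent
-- in H + v and v contributes its degree, which is at least one thanks to u. The bound |G| − 1 is the case of a single vertex H.
module Submission where

open import Defs
open import Data.Nat using (ℕ; zero; suc; _+_; _∸_; _≥_; _≤_; _<_; z≤n; s≤s; _⊔_)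
open import Data.Nat.Properties
  using (≤-refl; ≤-reflexive; ≤-trans; <-≤-trans; +-mono-≤; +-monoˡ-≤; +-mono-≤-<; m≤m⊔n; m≤n⊔m; ⊔-lub;
         +-suc; +-identityʳ; m≤n+m; n∸n≡0; suc-injective; module ≤-Reasoning)
open import Data.Bool using (Bool; true; false; _∧_; not; if_then_else_)
open import Data.Bool.Properties using (∧-conicalˡ; ∧-conicalʳ; ¬-not; not-injective) renaming (_≟_ to _≟ᵇ_)
open import Data.Product using (_×_; _,_; ∃-syntax)
open import Data.Sum using (_⊎_; inj₁; inj₂)
open import Data.Fin using (Fin; zero; suc)
open import Data.Fin.Properties using (all?; any?; ¬∀⟶∃¬)
open import Data.Vec using ([]; _∷_; lookup; tabulate; here; there)
open import Data.Vec.Properties using ([]=⇒lookup; lookup⇒[]=)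
open import Data.Fin.Subset using (Subset; ⊤; ⊥; ⁅_⁆; _∪_; _∈_; _∉_; _⊆_; ∣_∣; ∁)
open import Data.Fin.Subset.Properties
  using (_∈?_; ∈⊤; ⊆⊤; ⊥⊆; ∉⊥; ⊆-refl; ⊆-antisym; x∈p∪q⁻; p⊆p∪q; q⊆p∪q; x∈⁅x⁆; x∈⁅y⁆⇒x≡y;
         ∪-identityʳ; ∣∁p∣≡n∸∣p∣; ∣⊤∣≡n; ∣⁅x⁆∣≡1)
import Data.List as List
open import Data.List.Membership.Propositional using () renaming (_∈_ to _∈ₗ_)
open import Data.List.Membership.Propositional.Properties using (∈-map⁺; ∈-++⁺ˡ; ∈-++⁺ʳ)
import Data.List.Relation.Unary.Any as Any
open import Function using (_∘_)
open import Relation.Nullary using (yes; no; contradiction)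
open import Relation.Nullary.Decidable using (_×-dec_)
open import Relation.Binary.PropositionalEquality
  using (_≡_; refl; trans; cong; cong₂; subst; subst₂) renaming (sym to ≡-sym)

private
  variable
    n : ℕ

andV-tabulate⁻ : ∀ {f : Fin n → Bool} → andV (tabulate f) ≡ true → ∀ i → f i ≡ true
andV-tabulate⁻         h zero    = ∧-conicalˡ _ _ h
andV-tabulate⁻ {f = f} h (suc i) = andV-tabulate⁻ (∧-conicalʳ (f zero) _ h) i

andV-tabulate-false : ∀ {f : Fin n → Bool} → andV (tabulate f) ≡ false → ∃[ i ] f i ≡ false
andV-tabulate-false {n = suc n} {f} h with f zero in f₀
... | false = zero , f₀
... | true with andV-tabulate-false {f = f ∘ suc} h
...   | i , fi = suc i , fi

∧≡false : ∀ {a b} → a ∧ b ≡ false → a ≡ false ⊎ b ≡ false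
∧≡false {false} _ = inj₁ refl
∧≡false {true}  h = inj₂ h

sumV-tabulate-mono : ∀ {f g : Fin n → ℕ} → (∀ i → f i ≤ g i) → sumV (tabulate f) ≤ sumV (tabulate g)
sumV-tabulate-mono {n = zero}  _   = z≤n
sumV-tabulate-mono {n = suc n} f≤g = +-mono-≤ (f≤g zero) (sumV-tabulate-mono (f≤g ∘ suc))

sumV-tabulate-mono-< : ∀ {f g : Fin n → ℕ} j → (∀ i → f i ≤ g i) → f j < g j →
  sumV (tabulate f) < sumV (tabulate g)
sumV-tabulate-mono-< zero    f≤g fj<gj = +-mono-≤ fj<gj (sumV-tabulate-mono (f≤g ∘ suc))
sumV-tabulate-mono-< (suc j) f≤g fj<gj = +-mono-≤-< (f≤g zero) (sumV-tabulate-mono-< j (f≤g ∘ suc) fj<gj)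

if-mono : ∀ {a b : Bool} {m m′ : ℕ} → (a ≡ true → b ≡ true) → m ≤ m′ →
  (if a then m else 0) ≤ (if b then m′ else 0)
if-mono {false} _   _     = z≤n
if-mono {true}  a⇒b m≤m′ rewrite a⇒b refl = m≤m′

≤-foldr-⊔ : ∀ {A : Set} {f : A → ℕ} {x xs} → x ∈ₗ xs → f x ≤ List.foldr _⊔_ 0 (List.map f xs)
≤-foldr-⊔ (Any.here refl) = m≤m⊔n _ _
≤-foldr-⊔ {f = f} {xs = y List.∷ _} (Any.there x∈xs) = ≤-trans (≤-foldr-⊔ x∈xs) (m≤n⊔m (f y) _)

foldr-⊔-< : ∀ {A : Set} {f : A → ℕ} {m} xs → 0 < m → (∀ x → f x < m) → List.foldr _⊔_ 0 (List.map f xs) < m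
foldr-⊔-< List.[]       0<m _     = 0<m
foldr-⊔-< (x List.∷ xs) 0<m f<m = ⊔-lub (f<m x) (foldr-⊔-< xs 0<m f<m)

allSubsets-complete : (I : Subset n) → I ∈ₗ allSubsets n
allSubsets-complete {zero} []           = Any.here refl
allSubsets-complete {suc n} (true ∷ I)  = ∈-++⁺ˡ (∈-map⁺ (true ∷_) (allSubsets-complete I))
allSubsets-complete {suc n} (false ∷ I) =
  ∈-++⁺ʳ (List.map (true ∷_) (allSubsets n)) (∈-map⁺ (false ∷_) (allSubsets-complete I))

∈⇒lookup : ∀ {x : Fin n} {p} → x ∈ p → lookup p x ≡ true
∈⇒lookup = []=⇒lookup

lookup⇒∈ : ∀ {x : Fin n} {p} → lookup p x ≡ true → x ∈ p
lookup⇒∈ {x = x} {p} = lookup⇒[]= x p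

∉⇒lookup : ∀ {x : Fin n} {p} → x ∉ p → lookup p x ≡ false
∉⇒lookup x∉p = ¬-not (x∉p ∘ lookup⇒∈)

∈-∪⁅⁆⁻ : ∀ {x v : Fin n} p → x ∈ p ∪ ⁅ v ⁆ → x ≡ v ⊎ x ∈ p
∈-∪⁅⁆⁻ {v = v} p x∈ with x∈p∪q⁻ p ⁅ v ⁆ x∈
... | inj₁ x∈p   = inj₂ x∈p
... | inj₂ x∈⁅v⁆ = inj₁ (x∈⁅y⁆⇒x≡y v x∈⁅v⁆)

⊆-∪⁅⁆ : ∀ (p : Subset n) v → p ⊆ p ∪ ⁅ v ⁆
⊆-∪⁅⁆ p v = p⊆p∪q ⁅ v ⁆

∈-∪⁅⁆-self : ∀ (p : Subset n) v → v ∈ p ∪ ⁅ v ⁆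
∈-∪⁅⁆-self p v = q⊆p∪q p ⁅ v ⁆ (x∈⁅x⁆ v)

full-or-missing : (p : Subset n) → p ≡ ⊤ ⊎ ∃[ x ] x ∉ p
full-or-missing p with all? (_∈? p)
... | yes all∈ = inj₁ (⊆-antisym ⊆⊤ (λ {x} _ → all∈ x))
... | no ¬all∈ = inj₂ (¬∀⟶∃¬ _ (_∈ p) (_∈? p) ¬all∈)

∣∁⊤∣≡0 : ∀ n → ∣ ∁ (⊤ {n}) ∣ ≡ 0
∣∁⊤∣≡0 n = trans (∣∁p∣≡n∸∣p∣ (⊤ {n})) (trans (cong (n ∸_) (∣⊤∣≡n n)) (n∸n≡0 n))

∣∁⁅x⁆∣≡n∸1 : ∀ (x : Fin n) → ∣ ∁ ⁅ x ⁆ ∣ ≡ n ∸ 1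
∣∁⁅x⁆∣≡n∸1 {n} x = trans (∣∁p∣≡n∸∣p∣ ⁅ x ⁆) (cong (n ∸_) (∣⁅x⁆∣≡1 x))

x∉p⇒∣∁p∣≡1+∣∁[p∪⁅x⁆]∣ : ∀ {x : Fin n} {p} → x ∉ p → ∣ ∁ p ∣ ≡ suc ∣ ∁ (p ∪ ⁅ x ⁆) ∣
x∉p⇒∣∁p∣≡1+∣∁[p∪⁅x⁆]∣ {x = zero}  {true ∷ p}  x∉p = contradiction here x∉p
x∉p⇒∣∁p∣≡1+∣∁[p∪⁅x⁆]∣ {x = zero}  {false ∷ p} _   = cong (λ q → suc ∣ ∁ q ∣) (≡-sym (∪-identityʳ p))
x∉p⇒∣∁p∣≡1+∣∁[p∪⁅x⁆]∣ {x = suc x} {true ∷ p}  x∉p = x∉p⇒∣∁p∣≡1+∣∁[p∪⁅x⁆]∣ (x∉p ∘ there)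
x∉p⇒∣∁p∣≡1+∣∁[p∪⁅x⁆]∣ {x = suc x} {false ∷ p} x∉p = cong suc (x∉p⇒∣∁p∣≡1+∣∁[p∪⁅x⁆]∣ (x∉p ∘ there))

record IsIndependent (G : Graph n) (S I : Subset n) : Set where
  field
    ⊆S          : I ⊆ S
    nonadjacent : ∀ {u w} → u ∈ I → w ∈ I → adj G u w ≡ false
open IsIndependent

independent?⇒IsIndependent : ∀ (G : Graph n) {S I} → independent? G S I ≡ true → IsIndependent G S I
independent?⇒IsIndependent G {S} {I} h = record
  { ⊆S          = λ u∈I → lookup⇒∈ (inS _ (∈⇒lookup u∈I))
  ; nonadjacent = λ u∈I w∈I → nonadj _ _ (∈⇒lookup u∈I) (∈⇒lookup w∈I)
  }
  where
  inS : ∀ u → lookup I u ≡ true → lookup S u ≡ true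
  inS u Iu with lookup I u | Iu | andV-tabulate⁻ (∧-conicalˡ _ _ h) u
  ... | true | _ | Su = Su
  nonadj : ∀ u w → lookup I u ≡ true → lookup I w ≡ true → adj G u w ≡ false
  nonadj u w Iu Iw = not-injective (subst₂ (λ a b → not (a ∧ b ∧ adj G u w) ≡ true) Iu Iw
    (andV-tabulate⁻ (andV-tabulate⁻ (∧-conicalʳ _ _ h) u) w))

-- The disjunction inside independent? is local to Defs and cannot be named, so the
-- conjuncts are analysed through a failing instance instead of being proved directly.
IsIndependent⇒independent? : ∀ (G : Graph n) {S I} → IsIndependent G S I → independent? G S I ≡ true
IsIndependent⇒independent? G {S} {I} ind with independent? G S I in e
... | true = refl
... | false with ∧≡false e
...   | inj₁ outsideS with andV-tabulate-false outsideS
...     | u , fu with lookup I u in Iu | fu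
...       | true | Su = contradiction (trans (≡-sym Su) (∈⇒lookup (⊆S ind (lookup⇒∈ Iu)))) λ ()
IsIndependent⇒independent? G {S} {I} ind | false | inj₂ adjacent with andV-tabulate-false adjacent
...     | u , fu with andV-tabulate-false fu
...       | w , fuw with lookup I u in Iu | lookup I w in Iw | adj G u w in auw | fuw
...         | true | true | true | _ =
              contradiction (trans (≡-sym auw) (nonadjacent ind (lookup⇒∈ Iu) (lookup⇒∈ Iw))) λ ()

⊥-independent : ∀ (G : Graph n) S → IsIndependent G S ⊥
⊥-independent G S = record { ⊆S = ⊥⊆ ; nonadjacent = λ u∈⊥ _ → contradiction u∈⊥ ∉⊥ }

IsIndependent-⊆ : ∀ {G : Graph n} {S S′ I} → S ⊆ S′ → IsIndependent G S I → IsIndependent G S′ I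
IsIndependent-⊆ S⊆S′ ind = record { ⊆S = S⊆S′ ∘ ⊆S ind ; nonadjacent = nonadjacent ind }

IsIndependent-∪⁅⁆ : ∀ {G : Graph n} {S I v} → IsIndependent G S I → (∀ {x} → x ∈ I → adj G x v ≡ false) →
  IsIndependent G (S ∪ ⁅ v ⁆) (I ∪ ⁅ v ⁆)
IsIndependent-∪⁅⁆ {G = G} {S} {I} {v} ind v-isolated = record { ⊆S = ⊆S′ ; nonadjacent = nonadj }
  where
  ⊆S′ : I ∪ ⁅ v ⁆ ⊆ S ∪ ⁅ v ⁆
  ⊆S′ x∈ with ∈-∪⁅⁆⁻ I x∈
  ... | inj₁ refl = ∈-∪⁅⁆-self S v
  ... | inj₂ x∈I  = ⊆-∪⁅⁆ S v (⊆S ind x∈I)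
  nonadj : ∀ {u w} → u ∈ I ∪ ⁅ v ⁆ → w ∈ I ∪ ⁅ v ⁆ → adj G u w ≡ false
  nonadj u∈ w∈ with ∈-∪⁅⁆⁻ I u∈ | ∈-∪⁅⁆⁻ I w∈
  ... | inj₁ refl | inj₁ refl = irrefl G v
  ... | inj₁ refl | inj₂ w∈I  = trans (Graph.sym G v _) (v-isolated w∈I)
  ... | inj₂ u∈I  | inj₁ refl = v-isolated u∈I
  ... | inj₂ u∈I  | inj₂ w∈I  = nonadjacent ind u∈I w∈I

lookup-⊆ : ∀ {S S′ : Subset n} → S ⊆ S′ → ∀ {x} → lookup S x ≡ true → lookup S′ x ≡ true
lookup-⊆ S⊆S′ = ∈⇒lookup ∘ S⊆S′ ∘ lookup⇒∈

neighbour-count-mono : ∀ (G : Graph n) {S S′} v → S ⊆ S′ → ∀ u →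
  (if lookup S u ∧ adj G v u then 1 else 0) ≤ (if lookup S′ u ∧ adj G v u then 1 else 0)
neighbour-count-mono G v S⊆S′ u =
  if-mono (λ h → cong₂ _∧_ (lookup-⊆ S⊆S′ (∧-conicalˡ _ _ h)) (∧-conicalʳ _ _ h)) ≤-refl

deg-mono : ∀ (G : Graph n) {S S′} v → S ⊆ S′ → deg G S v ≤ deg G S′ v
deg-mono G v S⊆S′ = sumV-tabulate-mono (neighbour-count-mono G v S⊆S′)

deg-mono-< : ∀ (G : Graph n) {S S′ v w} → S ⊆ S′ → w ∉ S → w ∈ S′ → adj G v w ≡ true →
  deg G S v < deg G S′ v
deg-mono-< G {S} {S′} {v} {w} S⊆S′ w∉S w∈S′ avw =
  sumV-tabulate-mono-< w (neighbour-count-mono G v S⊆S′) counts-w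
  where
  counts-w : (if lookup S w ∧ adj G v w then 1 else 0) < (if lookup S′ w ∧ adj G v w then 1 else 0)
  counts-w rewrite ∉⇒lookup w∉S | ∈⇒lookup w∈S′ | avw = ≤-refl

0<deg : ∀ (G : Graph n) {S v w} → w ∈ S → adj G v w ≡ true → 0 < deg G S v
0<deg G w∈S avw = ≤-trans (s≤s z≤n) (deg-mono-< G ⊥⊆ ∉⊥ w∈S avw)

degSum-mono-< : ∀ (G : Graph n) {S S′ I J} j → S ⊆ S′ → I ⊆ J → j ∈ J →
  (if lookup I j then deg G S j else 0) < deg G S′ j → degSum G S I < degSum G S′ J
degSum-mono-< G {S} {S′} {I} {J} j S⊆S′ I⊆J j∈J gains-j =
  sumV-tabulate-mono-< j summand-mono
    (subst (λ b → _ < (if b then deg G S′ j else 0)) (≡-sym (∈⇒lookup j∈J)) gains-j)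
  where
  summand-mono : ∀ i → (if lookup I i then deg G S i else 0) ≤ (if lookup J i then deg G S′ i else 0)
  summand-mono i = if-mono (lookup-⊆ I⊆J) (deg-mono G i S⊆S′)

degSum≤mic : ∀ (G : Graph n) {S I} → IsIndependent G S I → degSum G S I ≤ mic G S
degSum≤mic G {S} {I} ind =
  subst (_≤ mic G S) (cong (λ b → if b then degSum G S I else 0) (IsIndependent⇒independent? G ind))
    (≤-foldr-⊔ (allSubsets-complete I))

mic-< : ∀ (G : Graph n) S {m} → (∀ {I} → IsIndependent G S I → degSum G S I < m) → mic G S < m
mic-< {n} G S {m} bound = foldr-⊔-< (allSubsets n) 0<m each
  where
  0<m : 0 < m
  0<m = ≤-trans (s≤s z≤n) (bound (⊥-independent G S))
  each : ∀ I → (if independent? G S I then degSum G S I else 0) < m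
  each I with independent? G S I in e
  ... | true  = bound (independent?⇒IsIndependent G {S} {I} e)
  ... | false = 0<m

degSum<mic-∪⁅⁆ : ∀ (G : Graph n) {H I u v} → u ∈ H → v ∉ H → adj G v u ≡ true → IsIndependent G H I →
  degSum G H I < mic G (H ∪ ⁅ v ⁆)
degSum<mic-∪⁅⁆ G {H} {I} {u} {v} u∈H v∉H avu ind with any? (λ x → x ∈? I ×-dec adj G x v ≟ᵇ true)
... | yes (x , x∈I , axv) =
  <-≤-trans (degSum-mono-< G x (⊆-∪⁅⁆ H v) ⊆-refl x∈I x-gains)
            (degSum≤mic G (IsIndependent-⊆ (⊆-∪⁅⁆ H v) ind))
  where
  x-gains : (if lookup I x then deg G H x else 0) < deg G (H ∪ ⁅ v ⁆) x
  x-gains rewrite ∈⇒lookup x∈I = deg-mono-< G (⊆-∪⁅⁆ H v) v∉H (∈-∪⁅⁆-self H v) axv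
... | no v-isolated =
  <-≤-trans (degSum-mono-< G v (⊆-∪⁅⁆ H v) (⊆-∪⁅⁆ I v) (∈-∪⁅⁆-self I v) v-gains)
            (degSum≤mic G (IsIndependent-∪⁅⁆ ind λ x∈I → ¬-not λ axv → v-isolated (_ , x∈I , axv)))
  where
  v-gains : (if lookup I v then deg G H v else 0) < deg G (H ∪ ⁅ v ⁆) v
  v-gains rewrite ∉⇒lookup (v∉H ∘ ⊆S ind) = 0<deg G (⊆-∪⁅⁆ H v u∈H) avu

mic-∪⁅⁆ : ∀ (G : Graph n) {H u v} → u ∈ H → v ∉ H → adj G v u ≡ true → mic G H < mic G (H ∪ ⁅ v ⁆)
mic-∪⁅⁆ G {H} u∈H v∉H avu = mic-< G H (degSum<mic-∪⁅⁆ G u∈H v∉H avu)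

Reach-mono : ∀ {G : Graph n} {S S′ a b} → S ⊆ S′ → Reach G S a b → Reach G S′ a b
Reach-mono S⊆S′ (here a∈S)       = here (S⊆S′ a∈S)
Reach-mono S⊆S′ (step a∈S e walk) = step (S⊆S′ a∈S) e (Reach-mono S⊆S′ walk)

Reach-snoc : ∀ {G : Graph n} {S a c b} → Reach G S a c → adj G c b ≡ true → b ∈ S → Reach G S a b
Reach-snoc (here a∈S)       e b∈S = step a∈S e (here b∈S)
Reach-snoc (step a∈S e walk) e′ b∈S = step a∈S e (Reach-snoc walk e′ b∈S)

boundary-edge : ∀ {G : Graph n} {S a b} H → Reach G S a b → a ∈ H → b ∉ H →
  ∃[ u ] ∃[ w ] u ∈ H × w ∉ H × adj G u w ≡ true
boundary-edge H (here _)                 a∈H a∉H = contradiction a∈H a∉H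
boundary-edge H (step {w = c} _ e walk) a∈H b∉H with c ∈? H
... | yes c∈H = boundary-edge H walk c∈H b∉H
... | no  c∉H = _ , c , a∈H , c∉H , e

Connected-∪⁅⁆ : ∀ (G : Graph n) {H u v} → u ∈ H → adj G u v ≡ true → Connected G H →
  Connected G (H ∪ ⁅ v ⁆)
Connected-∪⁅⁆ G {H} {u} {v} u∈H auv conn a b a∈ b∈ with ∈-∪⁅⁆⁻ H a∈ | ∈-∪⁅⁆⁻ H b∈
... | inj₁ refl | inj₁ refl = here a∈
... | inj₁ refl | inj₂ b∈H  = step a∈ (trans (Graph.sym G v u) auv) (Reach-mono (⊆-∪⁅⁆ H v) (conn u b u∈H b∈H))
... | inj₂ a∈H  | inj₁ refl = Reach-snoc (Reach-mono (⊆-∪⁅⁆ H v) (conn a u a∈H u∈H)) auv b∈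
... | inj₂ a∈H  | inj₂ b∈H  = Reach-mono (⊆-∪⁅⁆ H v) (conn a b a∈H b∈H)

Connected-⁅⁆ : ∀ (G : Graph n) v → Connected G ⁅ v ⁆
Connected-⁅⁆ G v a b a∈ b∈ with x∈⁅y⁆⇒x≡y v a∈ | x∈⁅y⁆⇒x≡y v b∈
... | refl | refl = here a∈

mic+∣∁∣≤mic⊤ : ∀ (G : Graph n) → Connected G ⊤ → ∀ H → NonEmpty H → Connected G H →
  mic G H + ∣ ∁ H ∣ ≤ mic G ⊤
mic+∣∁∣≤mic⊤ {n} G conn⊤ H = grow _ H refl
  where
  open ≤-Reasoning
  grow : ∀ k H → ∣ ∁ H ∣ ≡ k → NonEmpty H → Connected G H → mic G H + k ≤ mic G ⊤
  grow k H ∣∁H∣≡k (a , a∈H) connH with full-or-missing H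
  ... | inj₁ refl = ≤-reflexive (trans (cong (mic G ⊤ +_) (trans (≡-sym ∣∁H∣≡k) (∣∁⊤∣≡0 n))) (+-identityʳ _))
  ... | inj₂ (x , x∉H) with boundary-edge H (conn⊤ a x ∈⊤ ∈⊤) a∈H x∉H
  ...   | u , v , u∈H , v∉H , auv with k | trans (≡-sym ∣∁H∣≡k) (x∉p⇒∣∁p∣≡1+∣∁[p∪⁅x⁆]∣ v∉H)
  ...     | suc k | ∣∁H∣≡1+∣∁H′∣ = begin
    mic G H + suc k             ≡⟨ +-suc (mic G H) k ⟩
    suc (mic G H) + k           ≤⟨ +-monoˡ-≤ k (mic-∪⁅⁆ G u∈H v∉H (trans (Graph.sym G v u) auv)) ⟩
    mic G (H ∪ ⁅ v ⁆) + k       ≤⟨ grow k (H ∪ ⁅ v ⁆) (≡-sym (suc-injective ∣∁H∣≡1+∣∁H′∣))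
                                     (v , ∈-∪⁅⁆-self H v) (Connected-∪⁅⁆ G u∈H auv connH) ⟩
    mic G ⊤                     ∎

lemma6p1 : ∀ {n : ℕ} (G : Graph n) → NonEmpty {n} ⊤ → Connected G ⊤ →
    ((H : Subset n) → NonEmpty H → Connected G H →
      mic G ⊤ ≥ mic G H + ∣ ∁ H ∣)
    × (mic G ⊤ ≥ n ∸ 1)
lemma6p1 {n} G (w , _) conn⊤ = mic+∣∁∣≤mic⊤ G conn⊤ , singleton-bound
  where
  open ≤-Reasoning
  singleton-bound : mic G ⊤ ≥ n ∸ 1
  singleton-bound = begin
    n ∸ 1                        ≡⟨ ∣∁⁅x⁆∣≡n∸1 w ⟨
    ∣ ∁ ⁅ w ⁆ ∣                  ≤⟨ m≤n+m _ (mic G ⁅ w ⁆) ⟩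
    mic G ⁅ w ⁆ + ∣ ∁ ⁅ w ⁆ ∣    ≤⟨ mic+∣∁∣≤mic⊤ G conn⊤ ⁅ w ⁆ (w , x∈⁅x⁆ w) (Connected-⁅⁆ G w) ⟩
    mic G ⊤                      ∎
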